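{- Let $D$ be an $n\times n$ complex matrix, let $\lambda$ be a nonzero complex number, let $\alpha,\beta$ be $n\times 1$ complex column vectors, and let $L$ be an $n\times n$ complex matrix. Let $\mathbf{j}$ denote the $n\times 1$ all-ones column vector and $I$ the $n\times n$ identity matrix. If either (1) $\alpha^T D=\lambda \mathbf{j}^T$ and $LD+I=\beta\mathbf{j}^T$, or (2) $D\beta=\lambda\mathbf{j}$ and $DL+I=\mathbf{j}\alpha^T$, then $D$ is invertible and $D^{ -1}=-L+\frac{1}{\lambda}\beta\alpha^T$.
   Context: $M^T$ denotes the transpose of a matrix or vector $M$. -}

module Defs where

open import Level using (Level; _⊔_; suc)
open import Data.Nat using (ℕ)
open import Data.Fin using (Fin)
open import Data.Product using (_×_)
open import Relation.Nullary using (¬_)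
open import Algebra.Bundles using (CommutativeRing)
import Algebra.Properties.Monoid.Sum as MonoidSum

record Field (c ℓ : Level) : Set (Level.suc (c ⊔ ℓ)) where
  field
    commutativeRing : CommutativeRing c ℓ
  open CommutativeRing commutativeRing public
  field
    inv      : (x : Carrier) → ¬ (x ≈ 0#) → Carrier
    inverseʳ : (x : Carrier) (x≉0 : ¬ (x ≈ 0#)) → x * inv x x≉0 ≈ 1#
    0≉1      : ¬ (0# ≈ 1#)

module Matrices {c ℓ : Level} (R : CommutativeRing c ℓ) where
  open CommutativeRing R
  open MonoidSum +-monoid using (sum)

  Matrix : ℕ → ℕ → Set c
  Matrix m n = Fin m → Fin n → Carrier

  _⊗_ : {m k n : ℕ} → Matrix m k → Matrix k n → Matrix m n
  (A ⊗ B) i j = sum (λ l → A i l * B l j)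

  _⊕_ : {m n : ℕ} → Matrix m n → Matrix m n → Matrix m n
  (A ⊕ B) i j = A i j + B i j

  ⊖_ : {m n : ℕ} → Matrix m n → Matrix m n
  (⊖ A) i j = - (A i j)

  _·_ : {m n : ℕ} → Carrier → Matrix m n → Matrix m n
  (s · A) i j = s * A i j

  _ᵀ : {m n : ℕ} → Matrix m n → Matrix n m
  (A ᵀ) i j = A j i

  I : {n : ℕ} → Matrix n n
  I {n} i j with i Data.Fin.≟ j
  ... | Relation.Nullary.yes _ = 1#
  ... | Relation.Nullary.no  _ = 0#

  𝐣 : {n : ℕ} → Matrix n 1
  𝐣 _ _ = 1#

  _≈ᴹ_ : {m n : ℕ} → Matrix m n → Matrix m n → Set ℓ
  A ≈ᴹ B = ∀ i j → A i j ≈ B i j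

  IsInverse : {n : ℕ} → Matrix n n → Matrix n n → Set ℓ
  IsInverse A B = ((A ⊗ B) ≈ᴹ I) × ((B ⊗ A) ≈ᴹ I)

-- A one-sided inverse of a square matrix over a commutative ring is two-sided,
-- and a direct computation shows that -L + λ⁻¹βαᵀ is a one-sided inverse of D
-- (on the left in case (1), on the right in case (2)).
--
-- One-sidedness is removed without determinants and without deciding equality
-- in the ring: if M D = s I and P D = 0, then some power of s annihilates P.
-- By induction on the size: for each row l, the Schur complement of D l 0
-- (scaled by D l 0) satisfies the same hypotheses one size down with D l 0 · s
-- in place of s, so a power of D l 0 · s annihilates P.  These elements lie in
-- the radical of the annihilator of P, hence so does s · s = Σ_l M 0 l · D l 0 · s.
-- For X Y = I, take s = 1 and P = Y X - I.
module Submission where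

open import Defs
open import Level using (Level; _⊔_)
open import Data.Nat using (ℕ; zero; suc)
open import Data.Sum using (_⊎_; inj₁; inj₂)
open import Data.Product using (_×_; _,_; proj₁; proj₂; ∃-syntax)
open import Relation.Nullary using (¬_)

import Data.Nat as ℕ
open import Data.Nat.Properties using (+-suc)
open import Data.Fin using (Fin; zero; suc; punchIn; punchOut; _≟_)
open import Data.Fin.Properties using (punchIn-punchOut; punchInᵢ≢i)
open import Function using (_∘_)
open import Relation.Nullary using (yes; no; contradiction)
open import Relation.Binary.Bundles using (Setoid)
open import Relation.Binary.PropositionalEquality as ≡ using (_≢_)
open import Algebra.Bundles using (CommutativeRing)

module MatrixAlgebra {c ℓ : Level} (R : CommutativeRing c ℓ) where
  open CommutativeRing R hiding (zero)
  open Matrices R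
  open import Algebra.Properties.Ring ring
    using (-1*x≈-x; -‿distribˡ-*; -‿distribʳ-*; +-inverseˡ-unique; \\-leftDividesʳ)
  open import Algebra.Properties.Semiring.Sum semiring
    using (sum; sum-cong-≋; sum-replicate-zero; sum-remove; ∑-distrib-+; ∑-comm;
           *-distribˡ-sum; *-distribʳ-sum)
  open import Algebra.Properties.Semiring.Exp semiring using (_^_; ^-congˡ; ^-congʳ; ^-homo-*)
  open import Algebra.Properties.CommutativeSemiring.Exp commutativeSemiring
    using (^-distrib-*)
  open import Algebra.Solver.Ring.NaturalCoefficients.Default commutativeSemiring
    using (solve; _:=_; _:+_; _:*_)
  open import Relation.Binary.Reasoning.Setoid setoid

  sum-zero : ∀ {n} {f : Fin n → Carrier} → (∀ i → f i ≈ 0#) → sum f ≈ 0#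
  sum-zero {n} f≈0 = trans (sum-cong-≋ f≈0) (sum-replicate-zero n)

  sum-neg : ∀ {n} (f : Fin n → Carrier) → sum (λ i → - f i) ≈ - sum f
  sum-neg f = begin
    sum (λ i → - f i)       ≈⟨ sum-cong-≋ (λ i → sym (-1*x≈-x (f i))) ⟩
    sum (λ i → - 1# * f i)  ≈⟨ *-distribˡ-sum (- 1#) f ⟨
    - 1# * sum f            ≈⟨ -1*x≈-x (sum f) ⟩
    - sum f                 ∎

  sum-pick : ∀ {n} (i : Fin (suc n)) {f : Fin (suc n) → Carrier} →
             (∀ k → f (punchIn i k) ≈ 0#) → sum f ≈ f i
  sum-pick i {f} rest≈0 =
    trans (sum-remove {i = i} f) (trans (+-congˡ (sum-zero rest≈0)) (+-identityʳ (f i)))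

  I-diag : ∀ {n} (i : Fin n) → I i i ≈ 1#
  I-diag i with i ≟ i
  ... | yes _   = refl
  ... | no i≢i = contradiction ≡.refl i≢i

  I-offdiag : ∀ {n} {i j : Fin n} → i ≢ j → I i j ≈ 0#
  I-offdiag {i = i} {j} i≢j with i ≟ j
  ... | yes i≡j = contradiction i≡j i≢j
  ... | no _    = refl

  I-suc : ∀ {n} (i j : Fin n) → I (suc i) (suc j) ≈ I i j
  I-suc i j with i ≟ j
  ... | yes _ = refl
  ... | no _  = refl

  O : ∀ {m n} → Matrix m n
  O _ _ = 0#

  ≈ᴹ-setoid : ℕ → ℕ → Setoid c ℓ
  ≈ᴹ-setoid m n = record
    { Carrier       = Matrix m n
    ; _≈_           = _≈ᴹ_
    ; isEquivalence = record
      { refl  = λ i j → refl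
      ; sym   = λ A≈B i j → sym (A≈B i j)
      ; trans = λ A≈B B≈C i j → trans (A≈B i j) (B≈C i j)
      }
    }

  module _ {m n : ℕ} where

    ⊕-cong : {A A′ B B′ : Matrix m n} → A ≈ᴹ A′ → B ≈ᴹ B′ → (A ⊕ B) ≈ᴹ (A′ ⊕ B′)
    ⊕-cong A≈A′ B≈B′ i j = +-cong (A≈A′ i j) (B≈B′ i j)

    ⊕-congˡ : (A : Matrix m n) {B B′ : Matrix m n} → B ≈ᴹ B′ → (A ⊕ B) ≈ᴹ (A ⊕ B′)
    ⊕-congˡ A B≈B′ i j = +-congˡ (B≈B′ i j)

    ⊖-cong : {A A′ : Matrix m n} → A ≈ᴹ A′ → (⊖ A) ≈ᴹ (⊖ A′)
    ⊖-cong A≈A′ i j = -‿cong (A≈A′ i j)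

    ·-congˡ : (s : Carrier) {A A′ : Matrix m n} → A ≈ᴹ A′ → (s · A) ≈ᴹ (s · A′)
    ·-congˡ s A≈A′ i j = *-congˡ (A≈A′ i j)

    ·-inverse : ∀ {s t} → t * s ≈ 1# → (A : Matrix m n) → (s · (t · A)) ≈ᴹ A
    ·-inverse {s} {t} ts≈1 A i j = begin
      s * (t * A i j)  ≈⟨ solve 3 (λ s t a → s :* (t :* a) := (t :* s) :* a) refl s t (A i j) ⟩
      (t * s) * A i j  ≈⟨ *-congʳ ts≈1 ⟩
      1# * A i j       ≈⟨ *-identityˡ (A i j) ⟩
      A i j            ∎

    ⊕-inverseʳ : (A : Matrix m n) → (A ⊕ (⊖ A)) ≈ᴹ O
    ⊕-inverseʳ A i j = -‿inverseʳ (A i j)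

    ⊖-cancelˡ : (A B : Matrix m n) → ((⊖ A) ⊕ (A ⊕ B)) ≈ᴹ B
    ⊖-cancelˡ A B i j = \\-leftDividesʳ (A i j) (B i j)

  module _ {m k n : ℕ} where

    ⊗-congˡ : (A : Matrix m k) {B B′ : Matrix k n} → B ≈ᴹ B′ → (A ⊗ B) ≈ᴹ (A ⊗ B′)
    ⊗-congˡ A B≈B′ i j = sum-cong-≋ (λ l → *-congˡ (B≈B′ l j))

    ⊗-congʳ : {A A′ : Matrix m k} → A ≈ᴹ A′ → (B : Matrix k n) → (A ⊗ B) ≈ᴹ (A′ ⊗ B)
    ⊗-congʳ A≈A′ B i j = sum-cong-≋ (λ l → *-congʳ (A≈A′ i l))

    ⊗-distribʳ-⊕ : (A B : Matrix m k) (C : Matrix k n) →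
                   ((A ⊕ B) ⊗ C) ≈ᴹ ((A ⊗ C) ⊕ (B ⊗ C))
    ⊗-distribʳ-⊕ A B C i j =
      trans (sum-cong-≋ (λ l → distribʳ (C l j) (A i l) (B i l)))
            (∑-distrib-+ (λ l → A i l * C l j) (λ l → B i l * C l j))

    ⊗-distribˡ-⊕ : (A : Matrix m k) (B C : Matrix k n) →
                   (A ⊗ (B ⊕ C)) ≈ᴹ ((A ⊗ B) ⊕ (A ⊗ C))
    ⊗-distribˡ-⊕ A B C i j =
      trans (sum-cong-≋ (λ l → distribˡ (A i l) (B l j) (C l j)))
            (∑-distrib-+ (λ l → A i l * B l j) (λ l → A i l * C l j))

    ⊖-⊗ : (A : Matrix m k) (B : Matrix k n) → ((⊖ A) ⊗ B) ≈ᴹ (⊖ (A ⊗ B))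
    ⊖-⊗ A B i j =
      trans (sum-cong-≋ (λ l → sym (-‿distribˡ-* (A i l) (B l j)))) (sum-neg (λ l → A i l * B l j))

    ⊗-⊖ : (A : Matrix m k) (B : Matrix k n) → (A ⊗ (⊖ B)) ≈ᴹ (⊖ (A ⊗ B))
    ⊗-⊖ A B i j =
      trans (sum-cong-≋ (λ l → sym (-‿distribʳ-* (A i l) (B l j)))) (sum-neg (λ l → A i l * B l j))

    ·-⊗ : (s : Carrier) (A : Matrix m k) (B : Matrix k n) → ((s · A) ⊗ B) ≈ᴹ (s · (A ⊗ B))
    ·-⊗ s A B i j =
      trans (sum-cong-≋ (λ l → *-assoc s (A i l) (B l j)))
            (sym (*-distribˡ-sum s (λ l → A i l * B l j)))

    ⊗-· : (s : Carrier) (A : Matrix m k) (B : Matrix k n) → (A ⊗ (s · B)) ≈ᴹ (s · (A ⊗ B))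
    ⊗-· s A B i j = trans (sum-cong-≋ swap) (sym (*-distribˡ-sum s (λ l → A i l * B l j)))
      where
      swap : ∀ l → A i l * (s * B l j) ≈ s * (A i l * B l j)
      swap l = solve 3 (λ a s b → a :* (s :* b) := s :* (a :* b)) refl (A i l) s (B l j)

  ⊗-assoc : ∀ {m k l n} (A : Matrix m k) (B : Matrix k l) (C : Matrix l n) →
            ((A ⊗ B) ⊗ C) ≈ᴹ (A ⊗ (B ⊗ C))
  ⊗-assoc A B C i j = begin
    sum (λ q → sum (λ p → A i p * B p q) * C q j)
      ≈⟨ sum-cong-≋ (λ q → *-distribʳ-sum (C q j) (λ p → A i p * B p q)) ⟩
    sum (λ q → sum (λ p → (A i p * B p q) * C q j))
      ≈⟨ ∑-comm (λ q p → (A i p * B p q) * C q j) ⟩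
    sum (λ p → sum (λ q → (A i p * B p q) * C q j))
      ≈⟨ sum-cong-≋ (λ p → sum-cong-≋ (λ q → *-assoc (A i p) (B p q) (C q j))) ⟩
    sum (λ p → sum (λ q → A i p * (B p q * C q j)))
      ≈⟨ sum-cong-≋ (λ p → *-distribˡ-sum (A i p) (λ q → B p q * C q j)) ⟨
    sum (λ p → A i p * sum (λ q → B p q * C q j)) ∎

  ⊗-identityˡ : ∀ {m n} (A : Matrix m n) → (I ⊗ A) ≈ᴹ A
  ⊗-identityˡ {suc m} A i j =
    trans (sum-pick i {λ k → I i k * A k j} off-diagonal) (trans (*-congʳ (I-diag i)) (*-identityˡ _))
    where
    off-diagonal : ∀ k → I i (punchIn i k) * A (punchIn i k) j ≈ 0#
    off-diagonal k = trans (*-congʳ (I-offdiag (punchInᵢ≢i i k ∘ ≡.sym))) (zeroˡ _)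

  ⊗-identityʳ : ∀ {m n} (A : Matrix m n) → (A ⊗ I) ≈ᴹ A
  ⊗-identityʳ {n = suc n} A i j =
    trans (sum-pick j {λ k → A i k * I k j} off-diagonal) (trans (*-congˡ (I-diag j)) (*-identityʳ _))
    where
    off-diagonal : ∀ k → A i (punchIn j k) * I (punchIn j k) j ≈ 0#
    off-diagonal k = trans (*-congˡ (I-offdiag (punchInᵢ≢i j k))) (zeroʳ _)

  Annihilates : ∀ {m n} → Carrier → Matrix m n → Set ℓ
  Annihilates x P = (x · P) ≈ᴹ O

  √Ann : ∀ {m n} → Matrix m n → Carrier → Set ℓ
  √Ann P x = ∃[ e ] Annihilates (x ^ e) P

  deleteColumn : ∀ {m n} → Fin (suc n) → Matrix m (suc n) → Matrix m n
  deleteColumn l P r i = P r (punchIn l i)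

  annihilates-by-columns : ∀ {m n} {x} (P : Matrix m (suc n)) (l : Fin (suc n)) →
    (∀ r → x * P r l ≈ 0#) → Annihilates x (deleteColumn l P) → Annihilates x P
  annihilates-by-columns {x = x} P l column-l other-columns r k with l ≟ k
  ... | yes ≡.refl = column-l r
  ... | no l≢k     = ≡.subst (λ k → x * P r k ≈ 0#) (punchIn-punchOut l≢k)
                             (other-columns r (punchOut l≢k))

  module _ {m n : ℕ} (P : Matrix m n) where

    Ann-resp-≈ : ∀ {x y} → x ≈ y → Annihilates x P → Annihilates y P
    Ann-resp-≈ x≈y xP≈O r k = trans (*-congʳ (sym x≈y)) (xP≈O r k)

    Ann-*ˡ : ∀ x {y} → Annihilates y P → Annihilates (x * y) P
    Ann-*ˡ x {y} yP≈O r k = trans (*-assoc x y (P r k)) (trans (*-congˡ (yP≈O r k)) (zeroʳ x))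

    Ann-+ : ∀ {x y} → Annihilates x P → Annihilates y P → Annihilates (x + y) P
    Ann-+ {x} {y} xP≈O yP≈O r k =
      trans (distribʳ (P r k) x y) (trans (+-cong (xP≈O r k) (yP≈O r k)) (+-identityʳ 0#))

    -- The binomial argument, with the extra factor w making the induction go through.
    Ann-^-+ : ∀ {x y} A B w → Annihilates (x ^ A * w) P → Annihilates (y ^ B * w) P →
              Annihilates ((x + y) ^ (A ℕ.+ B) * w) P
    Ann-^-+ {x} {y} zero B w w·P≈O _ =
      Ann-*ˡ ((x + y) ^ B) (Ann-resp-≈ (*-identityˡ w) w·P≈O)
    Ann-^-+ {x} {y} (suc A) zero w _ w·P≈O =
      Ann-*ˡ ((x + y) ^ (suc A ℕ.+ zero)) (Ann-resp-≈ (*-identityˡ w) w·P≈O)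
    Ann-^-+ {x} {y} (suc A) (suc B) w x^A·w y^B·w =
      Ann-resp-≈ expand (Ann-+ (Ann-^-+ A (suc B) (x * w) x-part₁ x-part₂)
                               (Ann-resp-≈ (*-congʳ (^-congʳ (x + y) (≡.sym (+-suc A B))))
                                           (Ann-^-+ (suc A) B (y * w) y-part₁ y-part₂)))
      where
      p : Carrier
      p = (x + y) ^ (A ℕ.+ suc B)

      x-part₁ : Annihilates (x ^ A * (x * w)) P
      x-part₁ = Ann-resp-≈ (solve 3 (λ x a w → (x :* a) :* w := a :* (x :* w)) refl x (x ^ A) w) x^A·w

      x-part₂ : Annihilates (y ^ suc B * (x * w)) P
      x-part₂ = Ann-resp-≈ (solve 3 (λ x b w → x :* (b :* w) := b :* (x :* w)) refl x (y ^ suc B) w)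
                           (Ann-*ˡ x y^B·w)

      y-part₁ : Annihilates (x ^ suc A * (y * w)) P
      y-part₁ = Ann-resp-≈ (solve 3 (λ y a w → y :* (a :* w) := a :* (y :* w)) refl y (x ^ suc A) w)
                           (Ann-*ˡ y x^A·w)

      y-part₂ : Annihilates (y ^ B * (y * w)) P
      y-part₂ = Ann-resp-≈ (solve 3 (λ y b w → (y :* b) :* w := b :* (y :* w)) refl y (y ^ B) w) y^B·w

      expand : p * (x * w) + p * (y * w) ≈ ((x + y) * p) * w
      expand = solve 4 (λ p x y w → p :* (x :* w) :+ p :* (y :* w) := ((x :+ y) :* p) :* w)
                       refl p x y w

    √Ann-resp-≈ : ∀ {x y} → x ≈ y → √Ann P x → √Ann P y
    √Ann-resp-≈ x≈y (e , x^e·P≈O) = e , Ann-resp-≈ (^-congˡ e x≈y) x^e·P≈O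

    √Ann-*ˡ : ∀ x {y} → √Ann P y → √Ann P (x * y)
    √Ann-*ˡ x {y} (e , y^e·P≈O) = e , Ann-resp-≈ (sym (^-distrib-* x y e)) (Ann-*ˡ (x ^ e) y^e·P≈O)

    √Ann-+ : ∀ {x y} → √Ann P x → √Ann P y → √Ann P (x + y)
    √Ann-+ {x} {y} (A , x^A·P≈O) (B , y^B·P≈O) =
      A ℕ.+ B , Ann-resp-≈ (*-identityʳ _)
                  (Ann-^-+ A B 1# (Ann-resp-≈ (sym (*-identityʳ _)) x^A·P≈O)
                                  (Ann-resp-≈ (sym (*-identityʳ _)) y^B·P≈O))

    √Ann-0 : √Ann P 0#
    √Ann-0 = 1 , λ r k → trans (*-congʳ (zeroˡ 1#)) (zeroˡ (P r k))

    √Ann-sum : ∀ {k} (f : Fin k → Carrier) → (∀ i → √Ann P (f i)) → √Ann P (sum f)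
    √Ann-sum {zero}  f _      = √Ann-0
    √Ann-sum {suc k} f f∈√Ann = √Ann-+ (f∈√Ann zero) (√Ann-sum (f ∘ suc) (f∈√Ann ∘ suc))

    √Ann-square : ∀ {x} → √Ann P (x * x) → √Ann P x
    √Ann-square {x} (e , [x*x]^e·P≈O) =
      e ℕ.+ e , Ann-resp-≈ (trans (^-distrib-* x x e) (sym (^-homo-* x e e))) [x*x]^e·P≈O

    √Ann-1⇒≈O : √Ann P 1# → P ≈ᴹ O
    √Ann-1⇒≈O (e , 1^e·P≈O) r k =
      trans (sym (*-identityˡ (P r k))) (trans (*-congʳ (sym (1^e≈1 e))) (1^e·P≈O r k))
      where
      1^e≈1 : ∀ e → 1# ^ e ≈ 1#
      1^e≈1 zero    = refl
      1^e≈1 (suc e) = trans (*-identityˡ (1# ^ e)) (1^e≈1 e)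

  module Pivot {n : ℕ} (D : Matrix (suc n) (suc n)) (l : Fin (suc n)) where

    pivot : Carrier
    pivot = D l zero

    -- pivot times the Schur complement of the entry D l 0, so that no division is needed
    schurComplement : Matrix n n
    schurComplement i j = pivot * D (punchIn l i) (suc j) + - D (punchIn l i) zero * D l (suc j)

    module _ (x : Fin (suc n) → Carrier) (x·D₀≈0 : sum (λ k → x k * D k zero) ≈ 0#) where

      pivot-column : sum (λ i → x (punchIn l i) * - D (punchIn l i) zero) ≈ x l * pivot
      pivot-column = begin
        sum (λ i → x (punchIn l i) * - D (punchIn l i) zero)
          ≈⟨ sum-cong-≋ (λ i → sym (-‿distribʳ-* (x (punchIn l i)) (D (punchIn l i) zero))) ⟩
        sum (λ i → - (x (punchIn l i) * D (punchIn l i) zero))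
          ≈⟨ sum-neg (λ i → x (punchIn l i) * D (punchIn l i) zero) ⟩
        - sum (λ i → x (punchIn l i) * D (punchIn l i) zero)
          ≈⟨ +-inverseˡ-unique (x l * pivot) _ x·D₀≈0′ ⟨
        x l * pivot ∎
        where
        x·D₀≈0′ : x l * pivot + sum (λ i → x (punchIn l i) * D (punchIn l i) zero) ≈ 0#
        x·D₀≈0′ = trans (sym (sum-remove {i = l} (λ k → x k * D k zero))) x·D₀≈0

      schur-row : ∀ j → sum (λ i → x (punchIn l i) * schurComplement i j) ≈
                        pivot * sum (λ k → x k * D k (suc j))
      schur-row j = begin
        sum (λ i → x′ i * (a * E i j + c′ i * b))
        
          ≈⟨ sum-cong-≋ (λ i → expand (x′ i) (E i j) (c′ i)) ⟩
        sum (λ i → a * (x′ i * E i j) + (x′ i * c′ i) * b)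
        
          ≈⟨ ∑-distrib-+ (λ i → a * (x′ i * E i j)) (λ i → (x′ i * c′ i) * b) ⟩
        sum (λ i → a * (x′ i * E i j)) + sum (λ i → (x′ i * c′ i) * b)
        
          ≈⟨ +-cong (*-distribˡ-sum a (λ i → x′ i * E i j)) (*-distribʳ-sum b (λ i → x′ i * c′ i)) ⟨
        a * x′E + sum (λ i → x′ i * c′ i) * b
        
          ≈⟨ +-congˡ (*-congʳ pivot-column) ⟩
        a * x′E + (x l * a) * b
        
          ≈⟨ solve 4 (λ a t y b → a :* t :+ (y :* a) :* b := a :* (y :* b :+ t)) refl a x′E (x l) b ⟩
        a * (x l * b + x′E)
        
          ≈⟨ *-congˡ (sum-remove {i = l} (λ k → x k * D k (suc j))) ⟨
        a * sum (λ k → x k * D k (suc j)) ∎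
        where
        a b : Carrier
        a = pivot
        b = D l (suc j)

        x′ : Fin n → Carrier
        x′ i = x (punchIn l i)

        c′ : Fin n → Carrier
        c′ i = - D (punchIn l i) zero

        E : Matrix n n
        E i j = D (punchIn l i) (suc j)

        x′E : Carrier
        x′E = sum (λ i → x′ i * E i j)

        expand : ∀ y e c → y * (a * e + c * b) ≈ a * (y * e) + (y * c) * b
        expand y e c = solve 5 (λ a b y e c → y :* (a :* e :+ c :* b) := a :* (y :* e) :+ (y :* c) :* b)
                               refl a b y e c

    schur-left-inverse : ∀ {s} (M : Matrix (suc n) (suc n)) → (M ⊗ D) ≈ᴹ (s · I) →
                         (deleteColumn l (M ∘ suc) ⊗ schurComplement) ≈ᴹ ((pivot * s) · I)
    schur-left-inverse {s} M MD≈sI i j = begin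
      (deleteColumn l (M ∘ suc) ⊗ schurComplement) i j  ≈⟨ schur-row (M (suc i)) M₁D₀≈0 j ⟩
      pivot * (M ⊗ D) (suc i) (suc j)                   ≈⟨ *-congˡ (MD≈sI (suc i) (suc j)) ⟩
      pivot * (s * I (suc i) (suc j))                   ≈⟨ *-congˡ (*-congˡ (I-suc i j)) ⟩
      pivot * (s * I i j)                               ≈⟨ *-assoc pivot s (I i j) ⟨
      (pivot * s) * I i j                               ∎
      where
      M₁D₀≈0 : (M ⊗ D) (suc i) zero ≈ 0#
      M₁D₀≈0 = trans (MD≈sI (suc i) zero) (trans (*-congˡ (I-offdiag {i = suc i} {zero} λ ())) (zeroʳ s))

    module _ {m} (P : Matrix m (suc n)) (PD≈O : (P ⊗ D) ≈ᴹ O) where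

      schur-annihilated : (deleteColumn l P ⊗ schurComplement) ≈ᴹ O
      schur-annihilated r j =
        trans (schur-row (P r) (PD≈O r zero) j) (trans (*-congˡ (PD≈O r (suc j))) (zeroʳ pivot))

      √Ann-deleteColumn : ∀ {x} → √Ann (deleteColumn l P) (pivot * x) → √Ann P (pivot * x)
      √Ann-deleteColumn {x} (e , qP′≈O) = suc e , annihilates-by-columns P l column-l other-columns
        where
        q : Carrier
        q = (pivot * x) ^ e

        other-columns : Annihilates ((pivot * x) ^ suc e) (deleteColumn l P)
        other-columns = Ann-*ˡ (deleteColumn l P) (pivot * x) qP′≈O

        -- The extra factor pivot · x turns P r l into a combination of the other entries of row r.
        column-l : ∀ r → (pivot * x) ^ suc e * P r l ≈ 0#
        column-l r = begin
          (pivot * x * q) * P r l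
          
            ≈⟨ solve 4 (λ a x q p → (a :* x :* q) :* p := x :* (q :* (p :* a))) refl pivot x q (P r l) ⟩
          x * (q * (P r l * pivot))
          
            ≈⟨ *-congˡ (*-congˡ (pivot-column (P r) (PD≈O r zero))) ⟨
          x * (q * sum (λ i → P r (punchIn l i) * c′ i))
          
            ≈⟨ *-congˡ (*-distribˡ-sum q (λ i → P r (punchIn l i) * c′ i)) ⟩
          x * sum (λ i → q * (P r (punchIn l i) * c′ i))
          
            ≈⟨ *-congˡ (sum-zero vanish) ⟩
          x * 0#
          
            ≈⟨ zeroʳ x ⟩
          0# ∎
          where
          c′ : Fin n → Carrier
          c′ i = - D (punchIn l i) zero

          vanish : ∀ i → q * (P r (punchIn l i) * c′ i) ≈ 0#
          vanish i = trans (sym (*-assoc q _ (c′ i))) (trans (*-congʳ (qP′≈O r i)) (zeroˡ (c′ i)))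

  left-scalar-inverse⇒√Ann : ∀ n {m} (s : Carrier) (M D : Matrix n n) (P : Matrix m n) →
                             (M ⊗ D) ≈ᴹ (s · I) → (P ⊗ D) ≈ᴹ O → √Ann P s
  left-scalar-inverse⇒√Ann zero    s M D P _ _ = 0 , λ r ()
  left-scalar-inverse⇒√Ann (suc n) s M D P MD≈sI PD≈O =
    √Ann-square P (√Ann-resp-≈ P first-row≈s*s (√Ann-sum P (λ l → M zero l * (D l zero * s)) pivot-terms))
    where
    pivot-terms : ∀ l → √Ann P (M zero l * (D l zero * s))
    pivot-terms l = √Ann-*ˡ P (M zero l) (√Ann-deleteColumn P PD≈O
                 (left-scalar-inverse⇒√Ann n (pivot * s) (deleteColumn l (M ∘ suc)) schurComplement
                    (deleteColumn l P) (schur-left-inverse M MD≈sI) (schur-annihilated P PD≈O)))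
      where open Pivot D l

    first-row≈s*s : sum (λ l → M zero l * (D l zero * s)) ≈ s * s
    first-row≈s*s = begin
      sum (λ l → M zero l * (D l zero * s))
        ≈⟨ sum-cong-≋ (λ l → *-assoc (M zero l) (D l zero) s) ⟨
      sum (λ l → M zero l * D l zero * s)
        ≈⟨ *-distribʳ-sum s (λ l → M zero l * D l zero) ⟨
      (M ⊗ D) zero zero * s
        ≈⟨ *-congʳ (MD≈sI zero zero) ⟩
      s * I {suc n} zero zero * s
        ≈⟨ *-congʳ (trans (*-congˡ (I-diag {suc n} zero)) (*-identityʳ s)) ⟩
      s * s ∎

module InverseMatrices {c ℓ : Level} (R : CommutativeRing c ℓ) where
  open CommutativeRing R hiding (zero)
  open Matrices R
  open MatrixAlgebra R
  open import Algebra.Properties.Ring ring using (x∙y⁻¹≈ε⇒x≈y)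

  module _ {n : ℕ} where
    open import Relation.Binary.Reasoning.Setoid (≈ᴹ-setoid n n)

    left-inverse⇒right-inverse : (X Y : Matrix n n) → (X ⊗ Y) ≈ᴹ I → (Y ⊗ X) ≈ᴹ I
    left-inverse⇒right-inverse X Y XY≈I r k =
      x∙y⁻¹≈ε⇒x≈y ((Y ⊗ X) r k) (I r k) (√Ann-1⇒≈O P 1∈√AnnP r k)
      where
      P : Matrix n n
      P = (Y ⊗ X) ⊕ (⊖ I)

      PY≈O : (P ⊗ Y) ≈ᴹ O
      PY≈O = begin
        ((Y ⊗ X) ⊕ (⊖ I)) ⊗ Y          ≈⟨ ⊗-distribʳ-⊕ (Y ⊗ X) (⊖ I) Y ⟩
        ((Y ⊗ X) ⊗ Y) ⊕ ((⊖ I) ⊗ Y)    ≈⟨ ⊕-cong (⊗-assoc Y X Y) (⊖-⊗ I Y) ⟩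
        (Y ⊗ (X ⊗ Y)) ⊕ (⊖ (I ⊗ Y))    ≈⟨ ⊕-cong (⊗-congˡ Y XY≈I) (⊖-cong (⊗-identityˡ Y)) ⟩
        (Y ⊗ I) ⊕ (⊖ Y)                ≈⟨ ⊕-cong (⊗-identityʳ Y) (λ i j → refl) ⟩
        Y ⊕ (⊖ Y)                      ≈⟨ ⊕-inverseʳ Y ⟩
        O                              ∎

      1∈√AnnP : √Ann P 1#
      1∈√AnnP = left-scalar-inverse⇒√Ann n 1# X Y P (λ i j → trans (XY≈I i j) (sym (*-identityˡ (I i j))))
                                          PY≈O

    module _ (D L : Matrix n n) (α β : Matrix n 1) {λ₀ μ : Carrier} (λ₀μ≈1 : λ₀ * μ ≈ 1#) where

      rank-one-update-left-inverse :
        ((α ᵀ) ⊗ D) ≈ᴹ (λ₀ · (𝐣 ᵀ)) → ((L ⊗ D) ⊕ I) ≈ᴹ (β ⊗ (𝐣 ᵀ)) →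
        (((⊖ L) ⊕ (μ · (β ⊗ (α ᵀ)))) ⊗ D) ≈ᴹ I
      rank-one-update-left-inverse αᵀD≈λ₀jᵀ LD+I≈βjᵀ = begin
        ((⊖ L) ⊕ (μ · (β ⊗ (α ᵀ)))) ⊗ D        ≈⟨ ⊗-distribʳ-⊕ (⊖ L) (μ · (β ⊗ (α ᵀ))) D ⟩
        ((⊖ L) ⊗ D) ⊕ ((μ · (β ⊗ (α ᵀ))) ⊗ D)  ≈⟨ ⊕-cong (⊖-⊗ L D) (·-⊗ μ (β ⊗ (α ᵀ)) D) ⟩
        (⊖ (L ⊗ D)) ⊕ (μ · ((β ⊗ (α ᵀ)) ⊗ D))  ≈⟨ ⊕-congˡ _ (·-congˡ μ (⊗-assoc β (α ᵀ) D)) ⟩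
        (⊖ (L ⊗ D)) ⊕ (μ · (β ⊗ ((α ᵀ) ⊗ D)))  ≈⟨ ⊕-congˡ _ (·-congˡ μ (⊗-congˡ β αᵀD≈λ₀jᵀ)) ⟩
        (⊖ (L ⊗ D)) ⊕ (μ · (β ⊗ (λ₀ · (𝐣 ᵀ)))) ≈⟨ ⊕-congˡ _ (·-congˡ μ (⊗-· λ₀ β (𝐣 ᵀ))) ⟩
        (⊖ (L ⊗ D)) ⊕ (μ · (λ₀ · (β ⊗ (𝐣 ᵀ)))) ≈⟨ ⊕-congˡ _ (·-inverse λ₀μ≈1 (β ⊗ (𝐣 ᵀ))) ⟩
        (⊖ (L ⊗ D)) ⊕ (β ⊗ (𝐣 ᵀ))              ≈⟨ ⊕-congˡ _ LD+I≈βjᵀ ⟨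
        (⊖ (L ⊗ D)) ⊕ ((L ⊗ D) ⊕ I)            ≈⟨ ⊖-cancelˡ (L ⊗ D) I ⟩
        I                                      ∎

      rank-one-update-right-inverse :
        (D ⊗ β) ≈ᴹ (λ₀ · 𝐣) → ((D ⊗ L) ⊕ I) ≈ᴹ (𝐣 ⊗ (α ᵀ)) →
        (D ⊗ ((⊖ L) ⊕ (μ · (β ⊗ (α ᵀ))))) ≈ᴹ I
      rank-one-update-right-inverse Dβ≈λ₀j DL+I≈jαᵀ = begin
        D ⊗ ((⊖ L) ⊕ (μ · (β ⊗ (α ᵀ))))        ≈⟨ ⊗-distribˡ-⊕ D (⊖ L) (μ · (β ⊗ (α ᵀ))) ⟩
        (D ⊗ (⊖ L)) ⊕ (D ⊗ (μ · (β ⊗ (α ᵀ))))  ≈⟨ ⊕-cong (⊗-⊖ D L) (⊗-· μ D (β ⊗ (α ᵀ))) ⟩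
        (⊖ (D ⊗ L)) ⊕ (μ · (D ⊗ (β ⊗ (α ᵀ))))  ≈⟨ ⊕-congˡ _ (·-congˡ μ (⊗-assoc D β (α ᵀ))) ⟨
        (⊖ (D ⊗ L)) ⊕ (μ · ((D ⊗ β) ⊗ (α ᵀ)))  ≈⟨ ⊕-congˡ _ (·-congˡ μ (⊗-congʳ Dβ≈λ₀j (α ᵀ))) ⟩
        (⊖ (D ⊗ L)) ⊕ (μ · ((λ₀ · 𝐣) ⊗ (α ᵀ))) ≈⟨ ⊕-congˡ _ (·-congˡ μ (·-⊗ λ₀ 𝐣 (α ᵀ))) ⟩
        (⊖ (D ⊗ L)) ⊕ (μ · (λ₀ · (𝐣 ⊗ (α ᵀ)))) ≈⟨ ⊕-congˡ _ (·-inverse λ₀μ≈1 (𝐣 ⊗ (α ᵀ))) ⟩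
        (⊖ (D ⊗ L)) ⊕ (𝐣 ⊗ (α ᵀ))              ≈⟨ ⊕-congˡ _ DL+I≈jαᵀ ⟨
        (⊖ (D ⊗ L)) ⊕ ((D ⊗ L) ⊕ I)            ≈⟨ ⊖-cancelˡ (D ⊗ L) I ⟩
        I                                      ∎

lemma2p1 : {c ℓ : Level} (F : Field c ℓ) (n : ℕ)
    → let open Field F
          open Matrices commutativeRing
      in (D : Matrix n n) (λ₀ : Carrier) (λ≉0 : ¬ (λ₀ ≈ 0#))
         (α β : Matrix n 1) (L : Matrix n n)
       → ((((α ᵀ) ⊗ D) ≈ᴹ (λ₀ · (𝐣 ᵀ))) × (((L ⊗ D) ⊕ I) ≈ᴹ (β ⊗ (𝐣 ᵀ))))
         ⊎ (((D ⊗ β) ≈ᴹ (λ₀ · 𝐣)) × (((D ⊗ L) ⊕ I) ≈ᴹ (𝐣 ⊗ (α ᵀ))))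
       → IsInverse D ((⊖ L) ⊕ (inv λ₀ λ≉0 · (β ⊗ (α ᵀ))))
lemma2p1 F n D λ₀ λ≉0 α β L (inj₁ (αᵀD≈λ₀jᵀ , LD+I≈βjᵀ)) =
  left-inverse⇒right-inverse _ D MD≈I , MD≈I
  where
  open Field F using (commutativeRing; inv; inverseʳ)
  open Matrices commutativeRing
  open InverseMatrices commutativeRing
  MD≈I : (((⊖ L) ⊕ (inv λ₀ λ≉0 · (β ⊗ (α ᵀ)))) ⊗ D) ≈ᴹ I
  MD≈I = rank-one-update-left-inverse D L α β (inverseʳ λ₀ λ≉0) αᵀD≈λ₀jᵀ LD+I≈βjᵀ
lemma2p1 F n D λ₀ λ≉0 α β L (inj₂ (Dβ≈λ₀j , DL+I≈jαᵀ)) =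
  DM≈I , left-inverse⇒right-inverse D _ DM≈I
  where
  open Field F using (commutativeRing; inv; inverseʳ)
  open Matrices commutativeRing
  open InverseMatrices commutativeRing
  DM≈I : (D ⊗ ((⊖ L) ⊕ (inv λ₀ λ≉0 · (β ⊗ (α ᵀ))))) ≈ᴹ I
  DM≈I = rank-one-update-right-inverse D L α β (inverseʳ λ₀ λ≉0) Dβ≈λ₀j DL+I≈jαᵀ
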